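{- Let $i\ge7$. If $a>b\ge1$ are indices such that $2q_i=q_a+q_b$ and $q_a+q_b$ is an FQ-legal decomposition (i.e. $a-b\notin\{1,3,4\}$ and $\{a,b\}\neq\{1,3\}$), then $a=i+2$ and $b=i-5$.
   Context: Let $(q_i)_{i\ge1}$ be the Fibonacci Quilt sequence: $q_1=1,q_2=2,q_3=3,q_4=4$ and $q_i=q_{i-3}+q_{i-2}$ for $i\ge5$. An FQ-legal decomposition of a positive integer $m$ is an expression $m=q_{\ell_1}+\cdots+q_{\ell_t}$ with $\ell_1>\ell_2>\cdots>\ell_t$ such that $|\ell_i-\ell_j|\notin\{1,3,4\}$ for all $i\neq j$ and $\{1,3\}\not\subseteq\{\ell_1,\dots,\ell_t\}$. -}

module Defs where

open import Data.Nat using (ℕ; zero; suc; _+_; _∸_; _>_; _≥_)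
open import Data.List using (List; []; _∷_)
open import Data.List.Membership.Propositional using (_∈_)
open import Data.List.Relation.Unary.All using (All)
open import Data.Product using (_×_)
open import Data.Sum using (_⊎_)
open import Relation.Nullary using (¬_)
open import Relation.Binary.PropositionalEquality using (_≡_)

-- Fibonacci Quilt sequence, 1-indexed: q 1 = 1, q 2 = 2, q 3 = 3, q 4 = 4,
-- q i = q (i-3) + q (i-2) for i ≥ 5.  The value q 0 = 0 is a junk value
-- (index 0 is never used: all indices in the paper are ≥ 1).
q : ℕ → ℕ
q 0 = 0
q 1 = 1
q 2 = 2
q 3 = 3
q 4 = 4
q (suc (suc (suc (suc (suc n))))) = q (suc (suc n)) + q (suc (suc (suc n)))

dist : ℕ → ℕ → ℕ
dist m n = (m ∸ n) + (n ∸ m)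

BadGap : ℕ → Set
BadGap d = (d ≡ 1) ⊎ ((d ≡ 3) ⊎ (d ≡ 4))

data Decreasing : List ℕ → Set where
  dec-[] : Decreasing []
  dec-∷  : ∀ {x xs} → All (λ y → x > y) xs → Decreasing xs → Decreasing (x ∷ xs)

-- An index list ℓ₁ > … > ℓₜ (all ≥ 1) gives an FQ-legal decomposition
-- q ℓ₁ + … + q ℓₜ when all pairwise gaps avoid {1,3,4} and {1,3} ⊄ {ℓ₁,…,ℓₜ}.
FQLegal : List ℕ → Set
FQLegal ls =
  Decreasing ls ×
  (All (λ l → l ≥ 1) ls ×
  (((i j : ℕ) → i ∈ ls → j ∈ ls → ¬ (i ≡ j) → ¬ BadGap (dist i j)) ×
  ¬ ((1 ∈ ls) × (3 ∈ ls))))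

module Submission where

-- The sequence q is strictly increasing, so it is injective and
-- reflects the order.  Besides the defining recurrence
--   q (n+5) = q (n+2) + q (n+3)
-- we use the shifted identity  q (7+n) = q (6+n) + q (2+n).
-- Writing i = 7 + k we locate the larger index a relative to i:
--   * a ≤ i      : q a + q b < q i + q i, since q b < q a ≤ q i;
--   * a ≥ i + 3  : q a ≥ q (i+3) = q i + q (i+1) > 2·q i;
--   * a = i + 1  : cancelling forces q (5+k) < q b < q (6+k), i.e. an index
--                  strictly between two consecutive ones;
--   * a = i + 2  : cancelling forces q b = q (2+k), hence b = i − 5.

open import Defs
open import Data.Nat using (ℕ; _+_; _*_; _>_; _≥_; _∸_)
open import Data.List using (_∷_; [])
open import Data.Product using (_×_)
open import Relation.Binary.PropositionalEquality using (_≡_)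

open import Data.Nat using (zero; suc; _<_; _≤_; z≤n; s≤s)
open import Data.Nat.Properties
open import Data.Product using (_,_)
open import Data.Sum using (inj₁; inj₂)
open import Data.Empty using (⊥-elim)
open import Relation.Nullary using (¬_)
open import Relation.Binary using (tri<; tri≈; tri>)
open import Relation.Binary.PropositionalEquality using (refl; sym; cong; cong₂; module ≡-Reasoning)
open import Algebra.Properties.CommutativeSemigroup +-commutativeSemigroup using (interchange)

q-step : ∀ n → q n < q (suc n)
q-step 0 = n<1+n _
q-step 1 = n<1+n _
q-step 2 = n<1+n _
q-step 3 = n<1+n _
q-step 4 = n<1+n _
q-step (suc (suc (suc (suc (suc n))))) =
  +-mono-<-≤ (q-step (suc (suc n))) (<⇒≤ (q-step (suc (suc (suc n)))))

q-mono-< : ∀ {m n} → m < n → q m < q n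
q-mono-< {m} {suc n} (s≤s m≤n) with m≤n⇒m<n∨m≡n m≤n
... | inj₁ m<n  = <-trans (q-mono-< m<n) (q-step n)
... | inj₂ refl = q-step n

q-mono-≤ : ∀ {m n} → m ≤ n → q m ≤ q n
q-mono-≤ m≤n with m≤n⇒m<n∨m≡n m≤n
... | inj₁ m<n  = <⇒≤ (q-mono-< m<n)
... | inj₂ refl = ≤-refl

q-cancel-< : ∀ {m n} → q m < q n → m < n
q-cancel-< {m} {n} qm<qn with <-cmp m n
... | tri< m<n _ _ = m<n
... | tri≈ _ refl _ = ⊥-elim (<-irrefl refl qm<qn)
... | tri> _ _ n<m = ⊥-elim (<-asym qm<qn (q-mono-< n<m))

q-injective : ∀ {m n} → q m ≡ q n → m ≡ n
q-injective {m} {n} qm≡qn with <-cmp m n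
... | tri< m<n _ _ = ⊥-elim (<-irrefl qm≡qn (q-mono-< m<n))
... | tri≈ _ m≡n _ = m≡n
... | tri> _ _ n<m = ⊥-elim (<-irrefl (sym qm≡qn) (q-mono-< n<m))

-- It expresses q_(i+1) through q_i and splits q_i in a second way.
q-shifted : ∀ n → q (7 + n) ≡ q (6 + n) + q (2 + n)
q-shifted 0 = refl
q-shifted 1 = refl
q-shifted 2 = refl
q-shifted 3 = refl
q-shifted (suc (suc (suc (suc n)))) = begin
  q (8 + n) + q (9 + n)                              ≡⟨ cong₂ _+_ (q-shifted (suc n)) (q-shifted (suc (suc n))) ⟩
  (q (7 + n) + q (3 + n)) + (q (8 + n) + q (4 + n))  ≡⟨ interchange (q (7 + n)) _ _ _ ⟩
  (q (7 + n) + q (8 + n)) + (q (3 + n) + q (4 + n))  ∎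
  where open ≡-Reasoning

-- 2 * n unfolds to n + (n + 0); this is the form used in reasoning.
double : ∀ n → 2 * n ≡ n + n
double n = cong (n +_) (+-identityʳ n)

halve-cancel : ∀ p r s → 2 * p ≡ (p + r) + s → p ≡ r + s
halve-cancel p r s 2p≡p+r+s = +-cancelˡ-≡ p p (r + s) (begin
  p + p        ≡⟨ double p ⟨
  2 * p        ≡⟨ 2p≡p+r+s ⟩
  (p + r) + s  ≡⟨ +-assoc p r s ⟩
  p + (r + s)  ∎)
  where open ≡-Reasoning

sum-compensate : ∀ x y u v → x + y ≡ u + v → u < x → y < v
sum-compensate x y u v x+y≡u+v u<x with <-cmp y v
... | tri< y<v _ _ = y<v
... | tri≈ _ refl _ = ⊥-elim (<-irrefl (sym x+y≡u+v) (+-monoˡ-< y u<x))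
... | tri> _ _ v<y = ⊥-elim (<-irrefl (sym x+y≡u+v) (+-mono-< u<x v<y))

data Position (i a : ℕ) : Set where
  below    : a ≤ i → Position i a
  next     : a ≡ 1 + i → Position i a
  twoAbove : a ≡ 2 + i → Position i a
  farAbove : 3 + i ≤ a → Position i a

position : ∀ i a → Position i a
position zero    zero                = below z≤n
position zero    1                   = next refl
position zero    2                   = twoAbove refl
position zero    (suc (suc (suc a))) = farAbove (s≤s (s≤s (s≤s z≤n)))
position (suc i) zero                = below z≤n
position (suc i) (suc a) with position i a
... | below a≤i      = below (s≤s a≤i)
... | next refl      = next refl
... | twoAbove refl  = twoAbove refl
... | farAbove 3+i≤a = farAbove (s≤s 3+i≤a)

too-small : ∀ {i a b} → b < a → a ≤ i → q a + q b < 2 * q i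
too-small {i} {a} {b} b<a a≤i = begin-strict
  q a + q b  <⟨ +-monoʳ-< (q a) (q-mono-< b<a) ⟩
  q a + q a  ≤⟨ +-mono-≤ (q-mono-≤ a≤i) (q-mono-≤ a≤i) ⟩
  q i + q i  ≡⟨ double (q i) ⟨
  2 * q i    ∎
  where open ≤-Reasoning

too-large : ∀ {n a b} → 5 + n ≤ a → 2 * q (2 + n) < q a + q b
too-large {n} {a} {b} 5+n≤a = begin-strict
  2 * q (2 + n)          ≡⟨ double (q (2 + n)) ⟩
  q (2 + n) + q (2 + n)  <⟨ +-monoʳ-< (q (2 + n)) (q-step (2 + n)) ⟩
  q (5 + n)              ≤⟨ q-mono-≤ 5+n≤a ⟩
  q a                    ≤⟨ m≤m+n (q a) (q b) ⟩
  q a + q b              ∎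
  where open ≤-Reasoning

-- a = i + 1 is impossible: cancelling q_i from q_(i+1) = q_i + q_(i-4)
-- leaves q_i = q_(i-4) + q_b, and the two ways of splitting q_i,
-- q_(i-3) + q_(i-2) and q_(i-1) + q_(i-5), squeeze q_b strictly between
-- q_(i-2) and q_(i-1).
no-next : ∀ k b → ¬ (2 * q (7 + k) ≡ q (8 + k) + q b)
no-next k b 2qi≡qa+qb = <⇒≱ b<6+k 5+k<b
  where
    open ≡-Reasoning
    split : q (7 + k) ≡ q (3 + k) + q b
    split = halve-cancel (q (7 + k)) (q (3 + k)) (q b) (begin
      2 * q (7 + k)                  ≡⟨ 2qi≡qa+qb ⟩
      q (8 + k) + q b                ≡⟨ cong (_+ q b) (q-shifted (1 + k)) ⟩
      (q (7 + k) + q (3 + k)) + q b  ∎)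
    5+k<b : 5 + k < b
    5+k<b = q-cancel-< (sum-compensate (q (4 + k)) (q (5 + k)) (q (3 + k)) (q b)
                          split (q-step (3 + k)))
    b<6+k : b < 6 + k
    b<6+k = q-cancel-< (sum-compensate (q (3 + k)) (q b) (q (2 + k)) (q (6 + k))
      (begin
        q (3 + k) + q b       ≡⟨ split ⟨
        q (7 + k)             ≡⟨ q-shifted k ⟩
        q (6 + k) + q (2 + k) ≡⟨ +-comm (q (6 + k)) (q (2 + k)) ⟩
        q (2 + k) + q (6 + k) ∎)
      (q-step (2 + k)))

-- a = i + 2 forces q_b = q_(i-5): both q_(i+2) + q_b and 2 q_i equal
-- q_i + q_(i-1) plus q_b resp. q_(i-5).
two-above : ∀ k b → 2 * q (7 + k) ≡ q (9 + k) + q b → q b ≡ q (2 + k)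
two-above k b 2qi≡qa+qb = +-cancelˡ-≡ (q (6 + k)) (q b) (q (2 + k)) (begin
  q (6 + k) + q b        ≡⟨ halve-cancel (q (7 + k)) (q (6 + k)) (q b) (begin
                              2 * q (7 + k)                  ≡⟨ 2qi≡qa+qb ⟩
                              (q (6 + k) + q (7 + k)) + q b  ≡⟨ cong (_+ q b) (+-comm (q (6 + k)) _) ⟩
                              (q (7 + k) + q (6 + k)) + q b  ∎) ⟨
  q (7 + k)              ≡⟨ q-shifted k ⟩
  q (6 + k) + q (2 + k)  ∎)
  where open ≡-Reasoning

proposition2p1 : (i a b : ℕ) → i ≥ 7 → a > b → b ≥ 1 →
    2 * q i ≡ q a + q b → FQLegal (a ∷ b ∷ []) →
    (a ≡ i + 2) × (b ≡ i ∸ 5)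
proposition2p1 i a b i≥7 a>b _ 2qi≡qa+qb _ with m≤n⇒∃[o]m+o≡n i≥7
... | k , refl with position (7 + k) a
... | below a≤i      = ⊥-elim (<-irrefl (sym 2qi≡qa+qb) (too-small a>b a≤i))
... | next refl      = ⊥-elim (no-next k b 2qi≡qa+qb)
... | farAbove i+3≤a = ⊥-elim (<-irrefl 2qi≡qa+qb (too-large {n = 5 + k} {b = b} i+3≤a))
... | twoAbove refl  = +-comm 2 (7 + k) , q-injective (two-above k b 2qi≡qa+qb)
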